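{- Let $s,v,m$ be positive integers and $\epsilon\in\{1,-1\}$ (excluding $\epsilon=-1$, $vm^2\le4$) such that $d=svm/2$ and $k=s^2v(vm^2+4\epsilon)/4$ are integers, and let $f(x)=\dfrac{dx+k}{x+d}$. Let $a_0=0$, $a_1=1$, $a_{n+1}=v_nma_n+\epsilon a_{n-1}$, where $v_n=v$ for even $n$ and $v_n=1$ for odd $n$. Then for $n\ge1$, the iterate $f^n(\infty)$ is Pellian (i.e. equals $p/q$ with $p,q$ positive integers satisfying $p^2-kq^2=\pm1$) if and only if both of the following hold: (i) $n$ is even or $v=1$; (ii) $s$ divides $a_n$.
   Context: $f$ acts on $\mathbb{R}\cup\{\infty\}$ with $f(\infty)=d$; $f^n$ is its $n$-fold composite. -}

module Defs where

open import Data.Nat as ℕ using (ℕ; zero; suc)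
open import Data.Integer as ℤ using (ℤ; +_; -[1+_])
open import Data.Rational as ℚ using (ℚ; 0ℚ; _÷_; _/_; ≢-nonZero)
open import Data.Rational.Properties using (_≟_)
open import Data.Product using (Σ; _×_)
open import Data.Sum using (_⊎_)
open import Relation.Binary.PropositionalEquality using (_≡_)
open import Relation.Nullary using (yes; no)

data ℚ∞ : Set where
  ∞   : ℚ∞
  fin : ℚ → ℚ∞

iter : {A : Set} → (A → A) → ℕ → A → A
iter g zero    x = x
iter g (suc n) x = g (iter g n x)

-- f(x) = (d x + k)/(x + d), f(∞) = d, and f(-d) = ∞ (as a Möbius map; d·(-d)+k ≠ 0 here).
fMap : ℤ → ℤ → ℚ∞ → ℚ∞
fMap d k ∞ = fin (d / 1)
fMap d k (fin x) with x ℚ.+ (d / 1) ≟ 0ℚ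
... | yes _ = ∞
... | no ne = fin (_÷_ ((d / 1) ℚ.* x ℚ.+ (k / 1)) (x ℚ.+ (d / 1)) {{≢-nonZero ne}})

Pellian : ℤ → ℚ∞ → Set
Pellian k z =
  Σ ℕ λ p → Σ ℕ λ q → (0 ℕ.< p) × Σ (ℕ.NonZero q) λ nz →
    (z ≡ fin (_/_ (+ p) q {{nz}})) ×
    ((((+ p) ℤ.* (+ p)) ℤ.- (k ℤ.* ((+ q) ℤ.* (+ q))) ≡ + 1)
      ⊎ (((+ p) ℤ.* (+ p)) ℤ.- (k ℤ.* ((+ q) ℤ.* (+ q))) ≡ -[1+ 0 ]))

vSeq : ℕ → ℕ → ℕ
vSeq v zero          = v
vSeq v (suc zero)    = 1
vSeq v (suc (suc n)) = vSeq v n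

aSeq : ℕ → ℕ → ℤ → ℕ → ℤ
aSeq v m ε zero          = + 0
aSeq v m ε (suc zero)    = + 1
aSeq v m ε (suc (suc n)) =
  ((+ (vSeq v (suc n) ℕ.* m)) ℤ.* aSeq v m ε (suc n)) ℤ.+ (ε ℤ.* aSeq v m ε n)

-- Write f^n(∞) = num n / den n, where (num, den) starts at (1, 0) and is mapped to
-- (d num + k den, num + d den) at each step. Each step multiplies the norm num² - k den² by
-- D = d² - k = -s²vε, and den (n+2) = svm den (n+1) + s²vε den n. Comparing with
-- the recurrence of a gives den (2j+1) = (s²v)^j a (2j+1) and den (2j+2) = (s²v)^j sv a (2j+2).
-- A positive fraction P/Q is Pellian iff P = c p and Q = c q with p² - kq² = ±1, and then
-- P² - kQ² = ±c². For n = 2j+2 this forces c = (s²v)^(j+1), so q = a n / s. For n = 2j+1 it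
-- forces (a n)² = ±v (s q)², and since a (2j+1) ≡ ±1 (mod v) this leaves only v = 1.

module Submission where

open import Defs
open import Data.Nat as ℕ using (ℕ; zero; suc; z≤n; s≤s)
import Data.Nat.Properties as ℕP
open import Data.Nat.Divisibility as ℕD using ()
open import Data.Integer as ℤ using (ℤ; +_; -[1+_]; +[1+_]; _*_; _+_; _-_; -_; _^_)
import Data.Integer.Properties as ℤP
open import Data.Integer.Divisibility using (_∣_)
import Data.Integer.Divisibility.Signed as Signed
open import Data.Integer.Tactic.RingSolver using (solve-∀)
open import Data.Rational as ℚ using (0ℚ; _÷_; _/_)
import Data.Rational.Properties as ℚP
open import Data.Rational.Properties using (_≟_)
open import Data.Rational.Unnormalised as ℚᵘ using (mkℚᵘ; *≡*)
import Data.Rational.Unnormalised.Properties as ℚᵘP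
open import Data.Empty using (⊥-elim)
open import Data.Product as Product using (Σ; _×_; _,_)
open import Data.Sum using (_⊎_; inj₁; inj₂)
open import Function.Bundles using (_⇔_; mk⇔)
open import Relation.Binary.Definitions using (tri<; tri≈; tri>)
open import Relation.Binary.PropositionalEquality
open import Relation.Nullary using (¬_; yes; no; contradiction)

IsSign : ℤ → Set
IsSign e = e ≡ + 1 ⊎ e ≡ -[1+ 0 ]

sign*sign≡1 : ∀ {e} → IsSign e → e * e ≡ + 1
sign*sign≡1 (inj₁ refl) = refl
sign*sign≡1 (inj₂ refl) = refl

-‿sign : ∀ {e} → IsSign e → IsSign (- e)
-‿sign (inj₁ refl) = inj₂ refl
-‿sign (inj₂ refl) = inj₁ refl

*-sign : ∀ {e f} → IsSign e → IsSign f → IsSign (e * f)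
*-sign (inj₁ refl) (inj₁ refl) = inj₁ refl
*-sign (inj₁ refl) (inj₂ refl) = inj₂ refl
*-sign (inj₂ refl) (inj₁ refl) = inj₂ refl
*-sign (inj₂ refl) (inj₂ refl) = inj₁ refl

m*m≡n*n⇒m≡n : ∀ m n → m ℕ.* m ≡ n ℕ.* n → m ≡ n
m*m≡n*n⇒m≡n m n eq with ℕP.<-cmp m n
... | tri< m<n _ _ = contradiction eq (ℕP.<⇒≢ (ℕP.*-mono-< m<n m<n))
... | tri≈ _ m≡n _ = m≡n
... | tri> _ _ m>n = contradiction eq (ℕP.>⇒≢ (ℕP.*-mono-< m>n m>n))

x*x*e≡y*y⇒∣x∣≡∣y∣ : ∀ x y e → e * e ≡ + 1 → x * x * e ≡ y * y → ℤ.∣ x ∣ ≡ ℤ.∣ y ∣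
x*x*e≡y*y⇒∣x∣≡∣y∣ x y e e*e≡1 eq = m*m≡n*n⇒m≡n ℤ.∣ x ∣ ℤ.∣ y ∣ (begin
  ℤ.∣ x ∣ ℕ.* ℤ.∣ x ∣            ≡⟨ ℤP.abs-* x x ⟨
  ℤ.∣ x * x ∣                    ≡⟨ ℕP.*-identityʳ _ ⟨
  ℤ.∣ x * x ∣ ℕ.* 1              ≡⟨ cong (ℤ.∣ x * x ∣ ℕ.*_) ∣e∣≡1 ⟨
  ℤ.∣ x * x ∣ ℕ.* ℤ.∣ e ∣        ≡⟨ ℤP.abs-* (x * x) e ⟨
  ℤ.∣ x * x * e ∣                ≡⟨ cong ℤ.∣_∣ eq ⟩
  ℤ.∣ y * y ∣                    ≡⟨ ℤP.abs-* y y ⟩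
  ℤ.∣ y ∣ ℕ.* ℤ.∣ y ∣            ∎)
  where
  open ≡-Reasoning
  ∣e∣≡1 : ℤ.∣ e ∣ ≡ 1
  ∣e∣≡1 = ℕP.m*n≡1⇒m≡1 _ _ (trans (sym (ℤP.abs-* e e)) (cong ℤ.∣_∣ e*e≡1))

x*x*e≡[yz]²⇒y∣x : ∀ x y z {e} → e * e ≡ + 1 → x * x * e ≡ (y * z) * (y * z) → y ∣ x
x*x*e≡[yz]²⇒y∣x x y z {e} e*e≡1 eq =
  ℕD.divides ℤ.∣ z ∣ (trans (x*x*e≡y*y⇒∣x∣≡∣y∣ x (y * z) e e*e≡1 eq)
                           (trans (ℤP.abs-* y z) (ℕP.*-comm ℤ.∣ y ∣ ℤ.∣ z ∣)))

x*e≡y⇒x≡e*y : ∀ {x y e} → e * e ≡ + 1 → x * e ≡ y → x ≡ e * y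
x*e≡y⇒x≡e*y {x} {y} {e} e*e≡1 x*e≡y = begin
  x             ≡⟨ ℤP.*-identityʳ x ⟨
  x * + 1       ≡⟨ cong (x *_) e*e≡1 ⟨
  x * (e * e)   ≡⟨ ℤP.*-assoc x e e ⟨
  x * e * e     ≡⟨ cong (_* e) x*e≡y ⟩
  y * e         ≡⟨ ℤP.*-comm y e ⟩
  e * y         ∎
  where open ≡-Reasoning

x*x*e≡w*y⇒w∣x*x : ∀ x {w y e} → e * e ≡ + 1 → x * x * e ≡ w * y → w Signed.∣ x * x
x*x*e≡w*y⇒w∣x*x x {w} {y} {e} e*e≡1 eq =
  Signed.divides (e * y) (trans (x*e≡y⇒x≡e*y e*e≡1 eq) (rearrange e w y))
  where
  rearrange : ∀ e w y → e * (w * y) ≡ e * y * w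
  rearrange = solve-∀

∣x*x⇒∣x-u⇒∣u*u : ∀ {w} x u → w Signed.∣ x * x → w Signed.∣ x - u → w Signed.∣ u * u
∣x*x⇒∣x-u⇒∣u*u {w} x u w∣x² w∣x-u =
  subst (w Signed.∣_) (difference x u)
    (Signed.∣m∣n⇒∣m-n w∣x² (Signed.∣m⇒∣m*n (x + u) w∣x-u))
  where
  difference : ∀ x u → x * x - (x - u) * (x + u) ≡ u * u
  difference = solve-∀

*-cancelˡ-square : ∀ c {x y} .{{_ : ℤ.NonZero c}} → c * c * x ≡ c * c * y → x ≡ y
*-cancelˡ-square c {x} {y} eq = ℤP.*-cancelˡ-≡ c x y (ℤP.*-cancelˡ-≡ c (c * x) (c * y)
  (trans (sym (ℤP.*-assoc c c x)) (trans eq (ℤP.*-assoc c c y))))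

*≡⇒÷≡ : ∀ x y z .{{_ : ℚ.NonZero y}} → z ℚ.* y ≡ x → x ÷ y ≡ z
*≡⇒÷≡ x y z z*y≡x = begin
  x ℚ.* ℚ.1/ y          ≡⟨ cong (ℚ._* ℚ.1/ y) z*y≡x ⟨
  z ℚ.* y ℚ.* ℚ.1/ y    ≡⟨ ℚP.*-assoc z y (ℚ.1/ y) ⟩
  z ℚ.* (y ℚ.* ℚ.1/ y)  ≡⟨ cong (z ℚ.*_) (ℚP.*-inverseʳ y) ⟩
  z ℚ.* ℚ.1ℚ            ≡⟨ ℚP.*-identityʳ z ⟩
  z                     ∎
  where open ≡-Reasoning

toℚᵘ-/ : ∀ a q → ℚ.toℚᵘ (a / suc q) ℚᵘ.≃ mkℚᵘ a q
toℚᵘ-/ a q = ℚP.toℚᵘ-fromℚᵘ (mkℚᵘ a q)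

toℚᵘ-/+ : ∀ P q d → ℚ.toℚᵘ ((P / suc q) ℚ.+ (d / 1)) ℚᵘ.≃ mkℚᵘ (P + d * +[1+ q ]) q
toℚᵘ-/+ P q d = ℚᵘP.≃-trans (ℚP.toℚᵘ-homo-+ (P / suc q) (d / 1))
  (ℚᵘP.≃-trans (ℚᵘP.+-cong (toℚᵘ-/ P q) (toℚᵘ-/ d 0)) (*≡* (identity P d +[1+ q ])))
  where
  identity : ∀ P d Q → (P * + 1 + d * Q) * Q ≡ (P + d * Q) * (Q * + 1)
  identity = solve-∀

toℚᵘ-*/+ : ∀ d P q k → ℚ.toℚᵘ ((d / 1) ℚ.* (P / suc q) ℚ.+ (k / 1)) ℚᵘ.≃ mkℚᵘ (d * P + k * +[1+ q ]) q
toℚᵘ-*/+ d P q k = ℚᵘP.≃-trans (ℚP.toℚᵘ-homo-+ ((d / 1) ℚ.* (P / suc q)) (k / 1))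
  (ℚᵘP.≃-trans (ℚᵘP.+-cong (ℚᵘP.≃-trans (ℚP.toℚᵘ-homo-* (d / 1) (P / suc q))
                                        (ℚᵘP.*-cong (toℚᵘ-/ d 0) (toℚᵘ-/ P q)))
                           (toℚᵘ-/ k 0))
               (*≡* (identity d P k +[1+ q ])))
  where
  identity : ∀ d P k Q → ((d * P) * + 1 + k * (+ 1 * Q)) * Q ≡ (d * P + k * Q) * ((+ 1 * Q) * + 1)
  identity = solve-∀

fMap-fin : ∀ d k P q {A b} → A ≡ d * P + k * +[1+ q ] → +[1+ b ] ≡ P + d * +[1+ q ] →
           fMap d k (fin (P / suc q)) ≡ fin (A / suc b)
fMap-fin d k P q {A} {b} refl B≡ with (P / suc q) ℚ.+ (d / 1) ≟ 0ℚ
... | yes x+d≡0 = ⊥-elim (B≢0 (ℚᵘP.≃-trans (ℚᵘP.≃-sym (toℚᵘ-/+ P q d)) (ℚP.toℚᵘ-cong x+d≡0)))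
  where
  B≢0 : ¬ (mkℚᵘ (P + d * +[1+ q ]) q ℚᵘ.≃ mkℚᵘ (+ 0) 0)
  B≢0 (*≡* eq) with trans (cong (_* + 1) B≡) eq
  ... | ()
... | no x+d≢0 = cong fin (*≡⇒÷≡ _ _ _ {{ℚ.≢-nonZero x+d≢0}} (ℚP.toℚᵘ-injective (begin
  ℚ.toℚᵘ ((A / suc b) ℚ.* ((P / suc q) ℚ.+ (d / 1)))  ≈⟨ ℚP.toℚᵘ-homo-* (A / suc b) _ ⟩
  ℚ.toℚᵘ (A / suc b) ℚᵘ.* ℚ.toℚᵘ ((P / suc q) ℚ.+ (d / 1))
     ≈⟨ ℚᵘP.*-cong (toℚᵘ-/ A b) (toℚᵘ-/+ P q d) ⟩
  mkℚᵘ A b ℚᵘ.* mkℚᵘ (P + d * +[1+ q ]) q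
     ≈⟨ *≡* (trans (cong (λ B → A * B * +[1+ q ]) (sym B≡)) (ℤP.*-assoc A +[1+ b ] +[1+ q ])) ⟩
  mkℚᵘ A q                                            ≈⟨ toℚᵘ-*/+ d P q k ⟨
  ℚ.toℚᵘ ((d / 1) ℚ.* (P / suc q) ℚ.+ (k / 1))        ∎)))
  where
  open ℚᵘP.≃-Reasoning

Norm : ℤ → ℤ → ℤ → ℤ
Norm k x y = x * x - k * (y * y)

Norm-scale : ∀ k c x y → Norm k (c * x) (c * y) ≡ c * c * Norm k x y
Norm-scale = identity
  where
  identity : ∀ k c x y → (c * x) * (c * x) - k * ((c * y) * (c * y)) ≡ c * c * (x * x - k * (y * y))
  identity = solve-∀

module Orbit (d k : ℤ) where

  num den : ℕ → ℤ
  num zero    = + 1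
  num (suc n) = d * num n + k * den n
  den zero    = + 0
  den (suc n) = num n + d * den n

  Norm-orbit : ∀ n → Norm k (num n) (den n) ≡ (d * d - k) ^ n
  Norm-orbit zero    = identity k
    where
    identity : ∀ k → + 1 * + 1 - k * (+ 0 * + 0) ≡ + 1
    identity = solve-∀
  Norm-orbit (suc n) = trans (multiplicative d k (num n) (den n)) (cong ((d * d - k) *_) (Norm-orbit n))
    where
    multiplicative : ∀ d k x y → (d * x + k * y) * (d * x + k * y) - k * ((x + d * y) * (x + d * y))
                                 ≡ (d * d - k) * (x * x - k * (y * y))
    multiplicative = solve-∀

  den-recurrence : ∀ n → den (suc (suc n)) ≡ (+ 2 * d) * den (suc n) - (d * d - k) * den n
  den-recurrence n = identity d k (num n) (den n)
    where
    identity : ∀ d k x y → (d * x + k * y) + d * (x + d * y) ≡ (+ 2 * d) * (x + d * y) - (d * d - k) * y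
    identity = solve-∀

  num≡den-suc : ∀ n → num n ≡ den (suc n) - d * den n
  num≡den-suc n = identity (num n) d (den n)
    where
    identity : ∀ x d y → x ≡ (x + d * y) - d * y
    identity = solve-∀

IsPositiveRatio : ℤ → ℤ → ℚ∞ → Set
IsPositiveRatio P Q z =
  Σ ℕ λ p → Σ ℕ λ q → P ≡ +[1+ p ] × Q ≡ +[1+ q ] × z ≡ fin (+[1+ p ] / suc q)

module _ (d k : ℕ) where
  open Orbit +[1+ d ] (+ k)

  orbit-∞ : ∀ n → IsPositiveRatio (num (suc n)) (den (suc n)) (iter (fMap +[1+ d ] (+ k)) (suc n) ∞)
  orbit-∞ zero    = d , 0 , num-1 +[1+ d ] (+ k) , den-1 +[1+ d ] , refl
    where
    num-1 : ∀ d k → d * + 1 + k * + 0 ≡ d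
    num-1 = solve-∀
    den-1 : ∀ d → + 1 + d * + 0 ≡ + 1
    den-1 = solve-∀
  orbit-∞ (suc n) with orbit-∞ n
  ... | p , q , P≡ , Q≡ , z≡ =
        _ , _ , trans (cong₂ (λ x y → +[1+ d ] * x + + k * y) P≡ Q≡) (sym num-form) ,
        cong₂ (λ x y → x + +[1+ d ] * y) P≡ Q≡ ,
        trans (cong (fMap +[1+ d ] (+ k)) z≡) (fMap-fin +[1+ d ] (+ k) +[1+ p ] q num-form refl)
    where
    num-form : +[1+ d ] * +[1+ p ] + + (k ℕ.* suc q) ≡ +[1+ d ] * +[1+ p ] + + k * +[1+ q ]
    num-form = cong (λ y → +[1+ d ] * +[1+ p ] + y) (ℤP.pos-* k (suc q))

cross-multiple : ∀ k {P Q p q e} → p * Q ≡ P * q → Norm k p q ≡ e → e * e ≡ + 1 →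
                 Σ ℤ λ c → P ≡ c * p × Q ≡ c * q
cross-multiple k {P} {Q} {p} {q} {e} pQ≡Pq Npq≡e e*e≡1 =
  e * w , scaled P p (k * q) (P-identity k P Q p q) , scaled Q q p (Q-identity k P Q p q)
  where
  open ≡-Reasoning
  w : ℤ
  w = P * p - k * (Q * q)
  P-identity : ∀ k P Q p q → P * (p * p - k * (q * q))
                             ≡ (P * p - k * (Q * q)) * p + k * q * (p * Q - P * q)
  P-identity = solve-∀
  Q-identity : ∀ k P Q p q → Q * (p * p - k * (q * q))
                             ≡ (P * p - k * (Q * q)) * q + p * (p * Q - P * q)
  Q-identity = solve-∀
  scaled : ∀ X x y → X * Norm k p q ≡ w * x + y * (p * Q - P * q) → X ≡ e * w * x
  scaled X x y identity = trans (x*e≡y⇒x≡e*y e*e≡1 (begin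
    X * e                        ≡⟨ cong (X *_) Npq≡e ⟨
    X * Norm k p q               ≡⟨ identity ⟩
    w * x + y * (p * Q - P * q)  ≡⟨ cong (λ δ → w * x + y * δ) (ℤP.i≡j⇒i-j≡0 pQ≡Pq) ⟩
    w * x + y * + 0              ≡⟨ drop (w * x) y ⟩
    w * x                        ∎)) (sym (ℤP.*-assoc e w x))
    where
    drop : ∀ a b → a + b * + 0 ≡ a
    drop = solve-∀

cross-multiple⇒Norm : ∀ k {P Q p q e} → p * Q ≡ P * q → Norm k p q ≡ e → e * e ≡ + 1 →
                      Q * Q * e ≡ q * q * Norm k P Q
cross-multiple⇒Norm k {P} {Q} {p} {q} {e} pQ≡Pq Npq≡e e*e≡1
  with cross-multiple k {P} {Q} {p} {q} pQ≡Pq Npq≡e e*e≡1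
... | c , P≡ , Q≡ = begin
  Q * Q * e                       ≡⟨ cong (λ Q → Q * Q * e) Q≡ ⟩
  c * q * (c * q) * e             ≡⟨ rearrange c q e ⟩
  q * q * (c * c * e)             ≡⟨ cong (λ e → q * q * (c * c * e)) Npq≡e ⟨
  q * q * (c * c * Norm k p q)    ≡⟨ cong (q * q *_) (Norm-scale k c p q) ⟨
  q * q * Norm k (c * p) (c * q)  ≡⟨ cong₂ (λ P Q → q * q * Norm k P Q) P≡ Q≡ ⟨
  q * q * Norm k P Q              ∎
  where
  open ≡-Reasoning
  rearrange : ∀ c q e → c * q * (c * q) * e ≡ q * q * (c * c * e)
  rearrange = solve-∀

fin-injective : ∀ {x y} → fin x ≡ fin y → x ≡ y
fin-injective refl = refl

pellian⇒ : ∀ k {P Q z} → IsPositiveRatio P Q z → Pellian k z →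
           Σ ℕ λ q → Σ ℤ λ e → IsSign e × Q * Q * e ≡ +[1+ q ] * +[1+ q ] * Norm k P Q
pellian⇒ k _ (_ , zero , _ , () , _)
pellian⇒ k (p′ , q′ , refl , refl , refl) (p , suc q , _ , _ , z≡p/q , sign) =
  q , Norm k (+ p) +[1+ q ] , sign ,
  cross-multiple⇒Norm k {+[1+ p′ ]} {+[1+ q′ ]} {+ p} {+[1+ q ]} (sym cross) refl (sign*sign≡1 sign)
  where
  cross : +[1+ p′ ] * +[1+ q ] ≡ + p * +[1+ q′ ]
  cross = ℚᵘP.drop-*≡* (ℚP./-injective-≃ (mkℚᵘ +[1+ p′ ] q′) (mkℚᵘ (+ p) q) (fin-injective z≡p/q))

positive-factor : ∀ c {x n} → +[1+ n ] ≡ +[1+ c ] * x → Σ ℕ λ m → x ≡ +[1+ m ]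
positive-factor c {+ zero} eq = contradiction (trans eq (ℤP.*-zeroʳ +[1+ c ])) λ ()
positive-factor c {+[1+ m ]} _ = m , refl

⇒pellian : ∀ k {P Q z} c {p q e} {{_ : ℕ.NonZero c}} → IsPositiveRatio P Q z →
           P ≡ + c * p → Q ≡ + c * q → Norm k P Q ≡ + c * + c * e → IsSign e → Pellian k z
⇒pellian k zero {{()}}
⇒pellian k (suc c) {p} {q} {e} (p′ , q′ , refl , refl , refl) P≡ Q≡ N≡ sign
  with positive-factor c P≡ | positive-factor c Q≡
... | p₀ , refl | q₀ , refl =
  suc p₀ , suc q₀ , s≤s z≤n , _ ,
  cong fin (ℚP.fromℚᵘ-cong {mkℚᵘ +[1+ p′ ] q′} {mkℚᵘ +[1+ p₀ ] q₀} (*≡* cross)) ,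
  subst IsSign (sym Npq≡e) sign
  where
  open ≡-Reasoning
  C : ℤ
  C = +[1+ c ]
  cross : +[1+ p′ ] * +[1+ q₀ ] ≡ +[1+ p₀ ] * +[1+ q′ ]
  cross = begin
    +[1+ p′ ] * +[1+ q₀ ]         ≡⟨ cong (_* +[1+ q₀ ]) P≡ ⟩
    C * +[1+ p₀ ] * +[1+ q₀ ]     ≡⟨ rearrange C +[1+ p₀ ] +[1+ q₀ ] ⟩
    +[1+ p₀ ] * (C * +[1+ q₀ ])   ≡⟨ cong (+[1+ p₀ ] *_) Q≡ ⟨
    +[1+ p₀ ] * +[1+ q′ ]         ∎
    where
    rearrange : ∀ c p q → c * p * q ≡ p * (c * q)
    rearrange = solve-∀
  Npq≡e : Norm k +[1+ p₀ ] +[1+ q₀ ] ≡ e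
  Npq≡e = *-cancelˡ-square C (begin
    C * C * Norm k +[1+ p₀ ] +[1+ q₀ ]          ≡⟨ Norm-scale k C +[1+ p₀ ] +[1+ q₀ ] ⟨
    Norm k (C * +[1+ p₀ ]) (C * +[1+ q₀ ])      ≡⟨ cong₂ (Norm k) P≡ Q≡ ⟨
    Norm k +[1+ p′ ] +[1+ q′ ]                  ≡⟨ N≡ ⟩
    C * C * e                                   ∎)

even-or-odd : ∀ n → Σ ℕ λ j → n ≡ j ℕ.* 2 ⊎ n ≡ suc (j ℕ.* 2)
even-or-odd zero          = 0 , inj₁ refl
even-or-odd (suc zero)    = 0 , inj₂ refl
even-or-odd (suc (suc n)) with even-or-odd n
... | j , inj₁ refl = suc j , inj₁ refl
... | j , inj₂ refl = suc j , inj₂ refl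

2∤odd : ∀ j → ¬ (2 ℕD.∣ suc (j ℕ.* 2))
2∤odd j (ℕD.divides q odd≡q*2) = ℕP.even≢odd q j (begin
  2 ℕ.* q         ≡⟨ ℕP.*-comm 2 q ⟩
  q ℕ.* 2         ≡⟨ odd≡q*2 ⟨
  suc (j ℕ.* 2)   ≡⟨ cong suc (ℕP.*-comm j 2) ⟩
  suc (2 ℕ.* j)   ∎)
  where open ≡-Reasoning

pos-*₃ : ∀ a b c → + (a ℕ.* b ℕ.* c) ≡ + a * + b * + c
pos-*₃ a b c = trans (ℤP.pos-* (a ℕ.* b) c) (cong (_* + c) (ℤP.pos-* a b))

module Pellian-orbit (s v m : ℕ) {{_ : ℕ.NonZero s}} {{_ : ℕ.NonZero v}} (ε : ℤ) (ε-sign : IsSign ε)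
  (d′ k′ : ℕ) (2d≡svm : + 2 * +[1+ d′ ] ≡ + s * + v * + m)
  (d²-k≡ : +[1+ d′ ] * +[1+ d′ ] - + k′ ≡ - (+ s * + s * + v * ε)) where

  d k S V M T D : ℤ
  d = +[1+ d′ ]
  k = + k′
  S = + s
  V = + v
  M = + m
  T = S * S * V
  D = d * d - k

  open Orbit d k

  a : ℕ → ℤ
  a = aSeq v m ε

  t : ℕ
  t = s ℕ.* s ℕ.* v

  instance
    t≢0 : ℕ.NonZero t
    t≢0 = ℕP.m*n≢0 (s ℕ.* s) v {{ℕP.m*n≢0 s s}}

  -- (s²v)^j, computed in ℕ so that it is visibly nonzero.
  X : ℕ → ℤ
  X j = + (t ℕ.^ j)

  X-suc : ∀ j → X (suc j) ≡ T * X j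
  X-suc j = trans (ℤP.pos-* t (t ℕ.^ j)) (cong (_* X j) (pos-*₃ s s v))

  D-even : ∀ j → D ^ (j ℕ.* 2) ≡ X j * X j
  D-even zero    = refl
  D-even (suc j) = begin
    D * (D * D ^ (j ℕ.* 2))         ≡⟨ cong₂ (λ x y → x * (x * y)) d²-k≡ (D-even j) ⟩
    - (T * ε) * (- (T * ε) * (X j * X j)) ≡⟨ rearrange T ε (X j) ⟩
    ε * ε * (T * X j * (T * X j))   ≡⟨ cong (_* (T * X j * (T * X j))) (sign*sign≡1 ε-sign) ⟩
    + 1 * (T * X j * (T * X j))     ≡⟨ ℤP.*-identityˡ _ ⟩
    T * X j * (T * X j)             ≡⟨ cong (λ x → x * x) (X-suc j) ⟨
    X (suc j) * X (suc j)           ∎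
    where
    open ≡-Reasoning
    rearrange : ∀ T ε x → - (T * ε) * (- (T * ε) * (x * x)) ≡ ε * ε * (T * x * (T * x))
    rearrange = solve-∀

  den-rec : ∀ n → den (suc (suc n)) ≡ S * V * M * den (suc n) + T * ε * den n
  den-rec n = trans (den-recurrence n) (trans (cong₂ (λ x y → x * den (suc n) - y * den n) 2d≡svm d²-k≡)
                                              (identity (S * V * M) (den (suc n)) (T * ε) (den n)))
    where
    identity : ∀ A x B y → A * x - (- B) * y ≡ A * x + B * y
    identity = solve-∀

  vSeq-even : ∀ j → vSeq v (j ℕ.* 2) ≡ v
  vSeq-even zero    = refl
  vSeq-even (suc j) = vSeq-even j

  vSeq-odd : ∀ j → vSeq v (suc (j ℕ.* 2)) ≡ 1
  vSeq-odd zero    = refl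
  vSeq-odd (suc j) = vSeq-odd j

  a-rec : ∀ n → a (suc (suc n)) ≡ + vSeq v (suc n) * M * a (suc n) + ε * a n
  a-rec n = cong (λ x → x * a (suc n) + ε * a n) (ℤP.pos-* (vSeq v (suc n)) m)

  a-odd-rec : ∀ j → a (suc (suc j ℕ.* 2)) ≡ V * M * a (suc j ℕ.* 2) + ε * a (suc (j ℕ.* 2))
  a-odd-rec j = trans (a-rec (suc (j ℕ.* 2)))
    (cong (λ x → + x * M * a (suc j ℕ.* 2) + ε * a (suc (j ℕ.* 2))) (vSeq-even (suc j)))

  a-even-rec : ∀ j → a (suc (suc j) ℕ.* 2) ≡ M * a (suc (suc j ℕ.* 2)) + ε * a (suc j ℕ.* 2)
  a-even-rec j = trans (a-rec (suc j ℕ.* 2))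
    (trans (cong (λ x → + x * M * a (suc (suc j ℕ.* 2)) + ε * a (suc j ℕ.* 2)) (vSeq-odd (suc j)))
           (cong (λ x → x + ε * a (suc j ℕ.* 2)) (cong (_* a (suc (suc j ℕ.* 2))) (ℤP.*-identityˡ M))))

  den-odd : ∀ j → den (suc (j ℕ.* 2)) ≡ X j * a (suc (j ℕ.* 2))
  den-even : ∀ j → den (suc j ℕ.* 2) ≡ X j * (S * V) * a (suc j ℕ.* 2)

  den-odd zero    = identity d
    where
    identity : ∀ d → + 1 + d * + 0 ≡ + 1 * + 1
    identity = solve-∀
  den-odd (suc j) = begin
    den (suc (suc j ℕ.* 2))                                  ≡⟨ den-rec (suc (j ℕ.* 2)) ⟩
    S * V * M * den (suc j ℕ.* 2) + T * ε * den (suc (j ℕ.* 2))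
      ≡⟨ cong₂ (λ x y → S * V * M * x + T * ε * y) (den-even j) (den-odd j) ⟩
    S * V * M * (X j * (S * V) * A₂) + T * ε * (X j * A₁)   ≡⟨ identity S V M ε (X j) A₂ A₁ ⟩
    T * X j * (V * M * A₂ + ε * A₁)                          ≡⟨ cong₂ _*_ (X-suc j) (a-odd-rec j) ⟨
    X (suc j) * a (suc (suc j ℕ.* 2))                        ∎
    where
    open ≡-Reasoning
    A₁ A₂ : ℤ
    A₁ = a (suc (j ℕ.* 2))
    A₂ = a (suc j ℕ.* 2)
    identity : ∀ S V M ε x A₂ A₁ → S * V * M * (x * (S * V) * A₂) + S * S * V * ε * (x * A₁)
                                   ≡ S * S * V * x * (V * M * A₂ + ε * A₁)
    identity = solve-∀

  den-even zero    =
    trans (den-rec 0) (trans (identity S V M ε d) (cong (X 0 * (S * V) *_) (sym (a-rec 0))))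
    where
    identity : ∀ S V M ε d → S * V * M * (+ 1 + d * + 0) + S * S * V * ε * + 0
                             ≡ + 1 * (S * V) * (+ 1 * M * + 1 + ε * + 0)
    identity = solve-∀
  den-even (suc j) = begin
    den (suc (suc j) ℕ.* 2)                                     ≡⟨ den-rec (suc j ℕ.* 2) ⟩
    S * V * M * den (suc (suc j ℕ.* 2)) + T * ε * den (suc j ℕ.* 2)
      ≡⟨ cong₂ (λ x y → S * V * M * x + T * ε * y)
               (trans (den-odd (suc j)) (cong (_* A₃) (X-suc j))) (den-even j) ⟩
    S * V * M * (T * X j * A₃) + T * ε * (X j * (S * V) * A₂)  ≡⟨ identity S V M ε (X j) A₃ A₂ ⟩
    T * X j * (S * V) * (M * A₃ + ε * A₂)
      ≡⟨ cong₂ (λ x y → x * (S * V) * y) (X-suc j) (a-even-rec j) ⟨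
    X (suc j) * (S * V) * a (suc (suc j) ℕ.* 2)                ∎
    where
    open ≡-Reasoning
    A₂ A₃ : ℤ
    A₂ = a (suc j ℕ.* 2)
    A₃ = a (suc (suc j ℕ.* 2))
    identity : ∀ S V M ε x A₃ A₂ → S * V * M * (S * S * V * x * A₃) + S * S * V * ε * (x * (S * V) * A₂)
                                   ≡ S * S * V * x * (S * V) * (M * A₃ + ε * A₂)
    identity = solve-∀

  a-odd-residue : ∀ j → Σ ℤ λ u → IsSign u × V Signed.∣ a (suc (j ℕ.* 2)) - u
  a-odd-residue zero    = + 1 , inj₁ refl , Signed.divides (+ 0) refl
  a-odd-residue (suc j) with a-odd-residue j
  ... | u , u-sign , V∣a-u = ε * u , *-sign ε-sign u-sign ,
    subst (V Signed.∣_) (trans (identity V M ε (a (suc j ℕ.* 2)) (a (suc (j ℕ.* 2))) u)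
                               (cong (_- ε * u) (sym (a-odd-rec j))))
          (Signed.∣m∣n⇒∣m+n (Signed.∣m⇒∣m*n (M * a (suc j ℕ.* 2)) Signed.∣-refl) (Signed.∣n⇒∣m*n ε V∣a-u))
    where
    identity : ∀ V M ε A₂ A₁ u → V * (M * A₂) + ε * (A₁ - u) ≡ V * M * A₂ + ε * A₁ - ε * u
    identity = solve-∀

  f : ℚ∞ → ℚ∞
  f = fMap d k

  pellian-even⇒ : ∀ j → Pellian k (iter f (suc j ℕ.* 2) ∞) → S ∣ a (suc j ℕ.* 2)
  pellian-even⇒ j pl with pellian⇒ k (orbit-∞ d′ k′ (suc (j ℕ.* 2))) pl
  ... | q , e , e-sign , Q²e≡q²N = x*x*e≡[yz]²⇒y∣x A S Q (sign*sign≡1 e-sign) A²e≡[SQ]²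
    where
    open ≡-Reasoning
    n : ℕ
    n = suc j ℕ.* 2
    A Q : ℤ
    A = a n
    Q = +[1+ q ]
    rearrange : ∀ x S V A e → x * x * (S * S * (V * V * (A * A * e)))
                              ≡ x * (S * V) * A * (x * (S * V) * A) * e
    rearrange = solve-∀
    rearrange′ : ∀ x S V Q → Q * Q * (S * S * V * x * (S * S * V * x))
                             ≡ x * x * (S * S * (V * V * (S * Q * (S * Q))))
    rearrange′ = solve-∀
    A²e≡[SQ]² : A * A * e ≡ S * Q * (S * Q)
    A²e≡[SQ]² = *-cancelˡ-square V (*-cancelˡ-square S (*-cancelˡ-square (X j) {{ℕP.m^n≢0 t j}} (begin
      X j * X j * (S * S * (V * V * (A * A * e)))       ≡⟨ rearrange (X j) S V A e ⟩
      X j * (S * V) * A * (X j * (S * V) * A) * e       ≡⟨ cong (λ x → x * x * e) (den-even j) ⟨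
      den n * den n * e                                 ≡⟨ Q²e≡q²N ⟩
      Q * Q * Norm k (num n) (den n)                    ≡⟨ cong (Q * Q *_) (Norm-orbit n) ⟩
      Q * Q * D ^ n                                     ≡⟨ cong (Q * Q *_) (D-even (suc j)) ⟩
      Q * Q * (X (suc j) * X (suc j))                   ≡⟨ cong (λ x → Q * Q * (x * x)) (X-suc j) ⟩
      Q * Q * (T * X j * (T * X j))                     ≡⟨ rearrange′ (X j) S V Q ⟩
      X j * X j * (S * S * (V * V * (S * Q * (S * Q)))) ∎)))

  pellian-odd⇒a²e≡v[sq]² : ∀ j → Pellian k (iter f (suc (j ℕ.* 2)) ∞) →
                     Σ ℕ λ q → Σ ℤ λ e → IsSign e ×
                       a (suc (j ℕ.* 2)) * a (suc (j ℕ.* 2)) * e ≡ V * (S * +[1+ q ] * (S * +[1+ q ]))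
  pellian-odd⇒a²e≡v[sq]² j pl with pellian⇒ k (orbit-∞ d′ k′ (j ℕ.* 2)) pl
  ... | q , e , e-sign , Q²e≡q²N = q , - (ε * e) , -‿sign (*-sign ε-sign e-sign) , (begin
    A * A * - (ε * e)                      ≡⟨ rearrange A ε e ⟩
    - ε * (A * A * e)                      ≡⟨ cong (- ε *_) A²e≡ ⟩
    - ε * (Q * Q * - (T * ε))              ≡⟨ rearrange′ S V Q ε ⟩
    ε * ε * (V * (S * Q * (S * Q)))        ≡⟨ cong (_* (V * (S * Q * (S * Q)))) (sign*sign≡1 ε-sign) ⟩
    + 1 * (V * (S * Q * (S * Q)))          ≡⟨ ℤP.*-identityˡ _ ⟩
    V * (S * Q * (S * Q))                  ∎)
    where
    open ≡-Reasoning
    n : ℕ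
    n = suc (j ℕ.* 2)
    A Q : ℤ
    A = a n
    Q = +[1+ q ]
    rearrange : ∀ A ε e → A * A * - (ε * e) ≡ - ε * (A * A * e)
    rearrange = solve-∀
    rearrange′ : ∀ S V Q ε → - ε * (Q * Q * - (S * S * V * ε)) ≡ ε * ε * (V * (S * Q * (S * Q)))
    rearrange′ = solve-∀
    regroup : ∀ x A e → x * x * (A * A * e) ≡ x * A * (x * A) * e
    regroup = solve-∀
    regroup′ : ∀ x Q c → Q * Q * (c * (x * x)) ≡ x * x * (Q * Q * c)
    regroup′ = solve-∀
    A²e≡ : A * A * e ≡ Q * Q * - (T * ε)
    A²e≡ = *-cancelˡ-square (X j) {{ℕP.m^n≢0 t j}} (begin
      X j * X j * (A * A * e)              ≡⟨ regroup (X j) A e ⟩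
      X j * A * (X j * A) * e              ≡⟨ cong (λ x → x * x * e) (den-odd j) ⟨
      den n * den n * e                    ≡⟨ Q²e≡q²N ⟩
      Q * Q * Norm k (num n) (den n)       ≡⟨ cong (Q * Q *_) (Norm-orbit n) ⟩
      Q * Q * (D * D ^ (j ℕ.* 2))          ≡⟨ cong₂ (λ x y → Q * Q * (x * y)) d²-k≡ (D-even j) ⟩
      Q * Q * (- (T * ε) * (X j * X j))    ≡⟨ regroup′ (X j) Q (- (T * ε)) ⟩
      X j * X j * (Q * Q * - (T * ε))      ∎)

  V∣A²⇒v≡1 : ∀ j → V Signed.∣ a (suc (j ℕ.* 2)) * a (suc (j ℕ.* 2)) → v ≡ 1
  V∣A²⇒v≡1 j V∣A² with a-odd-residue j
  ... | u , u-sign , V∣A-u =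
    ℕD.∣1⇒≡1 (Signed.∣⇒∣ᵤ (subst (V Signed.∣_) (sign*sign≡1 u-sign)
                                 (∣x*x⇒∣x-u⇒∣u*u (a (suc (j ℕ.* 2))) u V∣A² V∣A-u)))

  pellian-odd⇒ : ∀ j → Pellian k (iter f (suc (j ℕ.* 2)) ∞) → v ≡ 1 × S ∣ a (suc (j ℕ.* 2))
  pellian-odd⇒ j pl = odd-case (pellian-odd⇒a²e≡v[sq]² j pl)
    where
    open ≡-Reasoning
    A : ℤ
    A = a (suc (j ℕ.* 2))
    odd-case : (Σ ℕ λ q → Σ ℤ λ e → IsSign e × A * A * e ≡ V * (S * +[1+ q ] * (S * +[1+ q ]))) →
               v ≡ 1 × S ∣ A
    odd-case (q , e , e-sign , A²e≡VY) = v≡1 , x*x*e≡[yz]²⇒y∣x A S (+[1+ q ]) (sign*sign≡1 e-sign) (begin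
      A * A * e           ≡⟨ A²e≡VY ⟩
      V * Y               ≡⟨ cong (λ v → + v * Y) v≡1 ⟩
      + 1 * Y             ≡⟨ ℤP.*-identityˡ Y ⟩
      Y                   ∎)
      where
      Y : ℤ
      Y = S * +[1+ q ] * (S * +[1+ q ])
      v≡1 : v ≡ 1
      v≡1 = V∣A²⇒v≡1 j (x*x*e≡w*y⇒w∣x*x A (sign*sign≡1 e-sign) A²e≡VY)

  even⇒pellian : ∀ j → S ∣ a (suc j ℕ.* 2) → Pellian k (iter f (suc j ℕ.* 2) ∞)
  even⇒pellian j S∣A with Signed.∣ᵤ⇒∣ S∣A
  ... | Signed.divides r A≡rS =
    ⇒pellian k (t ℕ.^ suc j) {{ℕP.m^n≢0 t (suc j)}} (orbit-∞ d′ k′ (suc (j ℕ.* 2))) num≡ den≡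
      (trans (Norm-orbit n) (trans (D-even (suc j)) (sym (ℤP.*-identityʳ _)))) (inj₁ refl)
    where
    open ≡-Reasoning
    n : ℕ
    n = suc j ℕ.* 2
    den≡ : den n ≡ X (suc j) * r
    den≡ = begin
      den n                        ≡⟨ den-even j ⟩
      X j * (S * V) * a n          ≡⟨ cong (X j * (S * V) *_) A≡rS ⟩
      X j * (S * V) * (r * S)      ≡⟨ rearrange (X j) S V r ⟩
      T * X j * r                  ≡⟨ cong (_* r) (X-suc j) ⟨
      X (suc j) * r                ∎
      where
      rearrange : ∀ x S V r → x * (S * V) * (r * S) ≡ S * S * V * x * r
      rearrange = solve-∀
    num≡ : num n ≡ X (suc j) * (a (suc n) - d * r)
    num≡ = begin
      num n                                   ≡⟨ num≡den-suc n ⟩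
      den (suc n) - d * den n                 ≡⟨ cong₂ (λ x y → x - d * y) (den-odd (suc j)) den≡ ⟩
      X (suc j) * a (suc n) - d * (X (suc j) * r)  ≡⟨ factor (X (suc j)) (a (suc n)) d r ⟩
      X (suc j) * (a (suc n) - d * r)         ∎
      where
      factor : ∀ c x d r → c * x - d * (c * r) ≡ c * (x - d * r)
      factor = solve-∀

  odd⇒pellian : ∀ j → v ≡ 1 → S ∣ a (suc (j ℕ.* 2)) → Pellian k (iter f (suc (j ℕ.* 2)) ∞)
  odd⇒pellian j v≡1 S∣A with Signed.∣ᵤ⇒∣ S∣A
  ... | Signed.divides r A≡rS =
    ⇒pellian k c {{ℕP.m*n≢0 (t ℕ.^ j) s {{ℕP.m^n≢0 t j}}}} (orbit-∞ d′ k′ (j ℕ.* 2)) num≡ den≡ Norm≡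
      (-‿sign (*-sign (inj₁ (cong +_ v≡1)) ε-sign))
    where
    open ≡-Reasoning
    n c : ℕ
    n = suc (j ℕ.* 2)
    c = t ℕ.^ j ℕ.* s
    c≡ : + c ≡ X j * S
    c≡ = ℤP.pos-* (t ℕ.^ j) s
    den≡ : den n ≡ + c * r
    den≡ = begin
      den n                ≡⟨ den-odd j ⟩
      X j * a n            ≡⟨ cong (X j *_) A≡rS ⟩
      X j * (r * S)        ≡⟨ rearrange (X j) r S ⟩
      X j * S * r          ≡⟨ cong (_* r) c≡ ⟨
      + c * r              ∎
      where
      rearrange : ∀ x r S → x * (r * S) ≡ x * S * r
      rearrange = solve-∀
    num≡ : num n ≡ + c * (V * a (suc n) - d * r)
    num≡ = begin
      num n                                    ≡⟨ num≡den-suc n ⟩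
      den (suc n) - d * den n                  ≡⟨ cong₂ (λ x y → x - d * y) (den-even j) den≡ ⟩
      X j * (S * V) * a (suc n) - d * (+ c * r)
        ≡⟨ cong (λ c → X j * (S * V) * a (suc n) - d * (c * r)) c≡ ⟩
      X j * (S * V) * a (suc n) - d * (X j * S * r) ≡⟨ factor (X j) S V (a (suc n)) d r ⟩
      X j * S * (V * a (suc n) - d * r)        ≡⟨ cong (_* (V * a (suc n) - d * r)) c≡ ⟨
      + c * (V * a (suc n) - d * r)            ∎
      where
      factor : ∀ x S V A d r → x * (S * V) * A - d * (x * S * r) ≡ x * S * (V * A - d * r)
      factor = solve-∀
    Norm≡ : Norm k (num n) (den n) ≡ + c * + c * - (V * ε)
    Norm≡ = begin
      Norm k (num n) (den n)                 ≡⟨ Norm-orbit n ⟩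
      D * D ^ (j ℕ.* 2)                      ≡⟨ cong₂ _*_ d²-k≡ (D-even j) ⟩
      - (T * ε) * (X j * X j)                ≡⟨ rearrange (X j) S V ε ⟩
      X j * S * (X j * S) * - (V * ε)        ≡⟨ cong (λ c → c * c * - (V * ε)) c≡ ⟨
      + c * + c * - (V * ε)                  ∎
      where
      rearrange : ∀ x S V ε → - (S * S * V * ε) * (x * x) ≡ x * S * (x * S) * - (V * ε)
      rearrange = solve-∀

  pellian⇔ : ∀ n → 1 ℕ.≤ n → Pellian k (iter f n ∞) ⇔ ((2 ℕD.∣ n ⊎ v ≡ 1) × S ∣ a n)
  pellian⇔ n 1≤n with even-or-odd n
  ... | zero  , inj₁ refl = contradiction 1≤n λ ()
  ... | suc j , inj₁ refl = mk⇔ (λ pl → inj₁ (ℕD.divides (suc j) refl) , pellian-even⇒ j pl)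
                                (λ (_ , S∣A) → even⇒pellian j S∣A)
  ... | j     , inj₂ refl = mk⇔ (λ pl → Product.map₁ inj₂ (pellian-odd⇒ j pl))
                                (λ (parity , S∣A) → odd⇒pellian j (v≡1 parity) S∣A)
    where
    v≡1 : 2 ℕD.∣ suc (j ℕ.* 2) ⊎ v ≡ 1 → v ≡ 1
    v≡1 (inj₁ 2∣n) = contradiction 2∣n (2∤odd j)
    v≡1 (inj₂ v≡1) = v≡1

positive-of-2* : ∀ {d n} → + 2 * d ≡ +[1+ n ] → Σ ℕ λ d′ → d ≡ +[1+ d′ ]
positive-of-2* {+[1+ d′ ]} _ = d′ , refl

nonnegative-of-4* : ∀ {k n} → + 4 * k ≡ + n → Σ ℕ λ k′ → k ≡ + k′
nonnegative-of-4* {+ k′} _ = k′ , refl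

v*m²+4ε-nonnegative : ∀ {x ε} → IsSign ε → ¬ (ε ≡ -[1+ 0 ] × x ℕ.≤ 4) → Σ ℕ λ y → + x + + 4 * ε ≡ + y
v*m²+4ε-nonnegative {x} (inj₁ refl) _ = x ℕ.+ 4 , refl
v*m²+4ε-nonnegative {x} (inj₂ refl) x≰4 with ℕP.≰⇒> (λ x≤4 → x≰4 (refl , x≤4))
... | s≤s (s≤s (s≤s (s≤s (s≤s {n = y} z≤n)))) = suc y , refl

k-nonnegative : ∀ N {x ε k} → IsSign ε → ¬ (ε ≡ -[1+ 0 ] × x ℕ.≤ 4) →
                + 4 * k ≡ + N * (+ x + + 4 * ε) → Σ ℕ λ k′ → k ≡ + k′
k-nonnegative N ε-sign excluded 4k≡ with v*m²+4ε-nonnegative ε-sign excluded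
... | y , bracket≡y = nonnegative-of-4* (trans 4k≡ (trans (cong (+ N *_) bracket≡y) (sym (ℤP.pos-* N y))))

d*d-k≡-s*s*v*ε : ∀ S V M ε d k → + 2 * d ≡ S * V * M → + 4 * k ≡ S * S * V * (V * (M * M) + + 4 * ε) →
                 d * d - k ≡ - (S * S * V * ε)
d*d-k≡-s*s*v*ε S V M ε d k 2d≡ 4k≡ = ℤP.*-cancelˡ-≡ (+ 4) _ _ (begin
  + 4 * (d * d - k)                             ≡⟨ expand d k ⟩
  + 2 * d * (+ 2 * d) - + 4 * k                 ≡⟨ cong₂ (λ x y → x * x - y) 2d≡ 4k≡ ⟩
  S * V * M * (S * V * M) - S * S * V * (V * (M * M) + + 4 * ε) ≡⟨ simplify S V M ε ⟩
  + 4 * - (S * S * V * ε)                       ∎)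
  where
  open ≡-Reasoning
  expand : ∀ d k → + 4 * (d * d - k) ≡ + 2 * d * (+ 2 * d) - + 4 * k
  expand = solve-∀
  simplify : ∀ S V M ε → S * V * M * (S * V * M) - S * S * V * (V * (M * M) + + 4 * ε)
                         ≡ + 4 * - (S * S * V * ε)
  simplify = solve-∀

pos-*-square : ∀ a b → + (a ℕ.* (b ℕ.* b)) ≡ + a * (+ b * + b)
pos-*-square a b = trans (ℤP.pos-* a (b ℕ.* b)) (cong (+ a *_) (ℤP.pos-* b b))

theorem6p1 : (s v m : ℕ) → 0 ℕ.< s → 0 ℕ.< v → 0 ℕ.< m →
    (ε : ℤ) → (ε ≡ + 1 ⊎ ε ≡ -[1+ 0 ]) →
    ¬ (ε ≡ -[1+ 0 ] × v ℕ.* (m ℕ.* m) ℕ.≤ 4) →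
    (d k : ℤ) →
    (+ 2) ℤ.* d ≡ + (s ℕ.* v ℕ.* m) →
    (+ 4) ℤ.* k ≡ (+ (s ℕ.* s ℕ.* v)) ℤ.* ((+ (v ℕ.* (m ℕ.* m))) ℤ.+ ((+ 4) ℤ.* ε)) →
    (n : ℕ) → 1 ℕ.≤ n →
    Pellian k (iter (fMap d k) n ∞) ⇔ (((2 ℕD.∣ n) ⊎ v ≡ 1) × ((+ s) ∣ aSeq v m ε n))
theorem6p1 (suc s) (suc v) (suc m) _ _ _ ε ε-sign excluded d k 2d≡svm 4k≡ n 1≤n
  with positive-of-2* 2d≡svm | k-nonnegative (suc s ℕ.* suc s ℕ.* suc v) ε-sign excluded 4k≡
... | d′ , refl | k′ , refl = pellian⇔ n 1≤n
  where
  2d≡svm′ : + 2 * +[1+ d′ ] ≡ + suc s * + suc v * + suc m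
  2d≡svm′ = trans 2d≡svm (pos-*₃ (suc s) (suc v) (suc m))
  4k≡′ : + 4 * + k′ ≡ + suc s * + suc s * + suc v * (+ suc v * (+ suc m * + suc m) + + 4 * ε)
  4k≡′ = trans 4k≡ (cong₂ (λ x y → x * (y + + 4 * ε))
                          (pos-*₃ (suc s) (suc s) (suc v)) (pos-*-square (suc v) (suc m)))
  open Pellian-orbit (suc s) (suc v) (suc m) ε ε-sign d′ k′ 2d≡svm′
    (d*d-k≡-s*s*v*ε (+ suc s) (+ suc v) (+ suc m) ε +[1+ d′ ] (+ k′) 2d≡svm′ 4k≡′)
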